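{- Let $E$ be a finite dimensional vector space and let $\mathcal{I}$ be a family of subspaces of $E$. Consider the conditions: (I1) $\mathcal{I}\neq\emptyset$. (I2) If $J\in\mathcal{I}$ and $I\subseteq J$, then $I\in\mathcal{I}$. (I3) If $I,J\in\mathcal{I}$ with $\dim I<\dim J$, then there is some $1$-dimensional subspace $x\subseteq J$, $x\not\subseteq I$ with $I+x\in\mathcal{I}$. (I1') $\mathbf{0}\in\mathcal{I}$, where $\mathbf{0}$ denotes the zero subspace. (I3') If $I,J\in\mathcal{I}$ with $\dim J=\dim I+1$, then there is some $1$-dimensional subspace $x\subseteq J$, $x\not\subseteq I$ with $I+x\in\mathcal{I}$. Then $\mathcal{I}$ satisfies (I1), (I2), (I3) if and only if it satisfies (I1'), (I2), (I3'). -}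

module Defs where

open import Level using (Level; _⊔_; Lift; lift; lower) renaming (suc to lsuc)
open import Data.Nat using (ℕ; zero; suc; _+_; _<_)
open import Data.Fin using (Fin; zero; suc)
open import Data.Product using (Σ; ∃; _×_; _,_)
open import Relation.Nullary using (¬_)
open import Algebra.Bundles using (CommutativeRing)
open import Algebra.Module.Bundles using (Module)

record IsField {c ℓ : Level} (K : CommutativeRing c ℓ) : Set (c ⊔ ℓ) where
  open CommutativeRing K
  field
    0≉1     : ¬ (0# ≈ 1#)
    inverse : ∀ x → ¬ (x ≈ 0#) → ∃ λ y → (x * y) ≈ 1#

module VectorSpace {c ℓ m ℓm : Level} (K : CommutativeRing c ℓ) (E : Module K m ℓm) where
  open CommutativeRing K using (Carrier; _≈_; 0#)
  open Module E

  linComb : ∀ {d} → (Fin d → Carrier) → (Fin d → Carrierᴹ) → Carrierᴹ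
  linComb {zero}  a v = 0ᴹ
  linComb {suc d} a v = (a zero *ₗ v zero) +ᴹ linComb (λ i → a (suc i)) (λ i → v (suc i))

  InSpan : ∀ {d} → (Fin d → Carrierᴹ) → Carrierᴹ → Set (c ⊔ ℓm)
  InSpan vs w = ∃ λ a → w ≈ᴹ linComb a vs

  LinearlyIndependent : ∀ {d} → (Fin d → Carrierᴹ) → Set (c ⊔ ℓ ⊔ ℓm)
  LinearlyIndependent vs = ∀ a → linComb a vs ≈ᴹ 0ᴹ → ∀ i → a i ≈ 0#

  FiniteDimensional : Set (c ⊔ m ⊔ ℓm)
  FiniteDimensional = ∃ λ d → Σ (Fin d → Carrierᴹ) λ vs → ∀ w → InSpan vs w

  -- subspaces of E (as predicates on E, closed under the operations;
  -- predicates live in the universe level m ⊔ ℓm of "subsets of E")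
  record Subspace : Set (c ⊔ lsuc (m ⊔ ℓm)) where
    field
      _∈_      : Carrierᴹ → Set (m ⊔ ℓm)
      ∈-resp-≈ : ∀ {u v} → u ≈ᴹ v → _∈_ u → _∈_ v
      0∈       : _∈_ 0ᴹ
      +-closed : ∀ {u v} → _∈_ u → _∈_ v → _∈_ (u +ᴹ v)
      *-closed : ∀ a {u} → _∈_ u → _∈_ (a *ₗ u)
  open Subspace public using (_∈_)

  _⊆_ : Subspace → Subspace → Set (m ⊔ ℓm)
  U ⊆ W = ∀ v → U ∈ v → W ∈ v

  zeroSub : Subspace
  zeroSub = record
    { _∈_ = λ v → Lift m (v ≈ᴹ 0ᴹ)
    ; ∈-resp-≈ = λ u≈v u≈0 → lift (≈ᴹ-trans (≈ᴹ-sym u≈v) (lower u≈0))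
    ; 0∈ = lift ≈ᴹ-refl
    ; +-closed = λ u≈0 v≈0 → lift (≈ᴹ-trans (+ᴹ-cong (lower u≈0) (lower v≈0)) (+ᴹ-identityˡ 0ᴹ))
    ; *-closed = λ a u≈0 → lift (≈ᴹ-trans (*ₗ-congˡ (lower u≈0)) (*ₗ-zeroʳ a))
    }

  _⊕_ : Subspace → Subspace → Subspace
  U ⊕ W = record
    { _∈_ = λ v → ∃ λ u → ∃ λ w → U ∈ u × W ∈ w × v ≈ᴹ (u +ᴹ w)
    ; ∈-resp-≈ = λ { u≈v (a , b , a∈ , b∈ , eq) → a , b , a∈ , b∈ , ≈ᴹ-trans (≈ᴹ-sym u≈v) eq }
    ; 0∈ = 0ᴹ , 0ᴹ , Subspace.0∈ U , Subspace.0∈ W , ≈ᴹ-sym (+ᴹ-identityˡ 0ᴹ)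
    ; +-closed = λ { (a , b , a∈ , b∈ , e) (a' , b' , a'∈ , b'∈ , e') →
        (a +ᴹ a') , (b +ᴹ b') , Subspace.+-closed U a∈ a'∈ , Subspace.+-closed W b∈ b'∈ ,
        ≈ᴹ-trans (+ᴹ-cong e e') (swap a b a' b') }
    ; *-closed = λ { r (a , b , a∈ , b∈ , e) →
        (r *ₗ a) , (r *ₗ b) , Subspace.*-closed U r a∈ , Subspace.*-closed W r b∈ ,
        ≈ᴹ-trans (*ₗ-congˡ e) (*ₗ-distribˡ r a b) }
    }
    where
    swap : ∀ a b a' b' → ((a +ᴹ b) +ᴹ (a' +ᴹ b')) ≈ᴹ ((a +ᴹ a') +ᴹ (b +ᴹ b'))
    swap a b a' b' = ≈ᴹ-trans (+ᴹ-assoc a b (a' +ᴹ b'))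
      (≈ᴹ-trans (+ᴹ-cong ≈ᴹ-refl (≈ᴹ-trans (≈ᴹ-sym (+ᴹ-assoc b a' b'))
        (≈ᴹ-trans (+ᴹ-cong (+ᴹ-comm b a') ≈ᴹ-refl) (+ᴹ-assoc a' b b'))))
        (≈ᴹ-sym (+ᴹ-assoc a a' (b +ᴹ b'))))

  IsBasisOf : ∀ {d} → Subspace → (Fin d → Carrierᴹ) → Set (c ⊔ ℓ ⊔ m ⊔ ℓm)
  IsBasisOf W vs = (∀ i → W ∈ vs i) × LinearlyIndependent vs × (∀ w → W ∈ w → InSpan vs w)

  HasDim : Subspace → ℕ → Set (c ⊔ ℓ ⊔ m ⊔ ℓm)
  HasDim W d = Σ (Fin d → Carrierᴹ) (IsBasisOf W)

  DimLt : Subspace → Subspace → Set (c ⊔ ℓ ⊔ m ⊔ ℓm)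
  DimLt U W = ∃ λ d → ∃ λ e → HasDim U d × HasDim W e × d < e

  DimSucc : Subspace → Subspace → Set (c ⊔ ℓ ⊔ m ⊔ ℓm)
  DimSucc U W = ∃ λ d → HasDim U d × HasDim W (d + 1)

  module Conditions {q : Level} (𝓘 : Subspace → Set q) where
    I1 : Set (c ⊔ lsuc (m ⊔ ℓm) ⊔ q)
    I1 = ∃ λ (I : Subspace) → 𝓘 I

    I2 : Set (c ⊔ lsuc (m ⊔ ℓm) ⊔ q)
    I2 = ∀ (I J : Subspace) → 𝓘 J → I ⊆ J → 𝓘 I

    Extends : Subspace → Subspace → Set (c ⊔ ℓ ⊔ lsuc (m ⊔ ℓm) ⊔ q)
    Extends I J = ∃ λ (x : Subspace) → HasDim x 1 × x ⊆ J × ¬ (x ⊆ I) × 𝓘 (I ⊕ x)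

    I3 : Set (c ⊔ ℓ ⊔ lsuc (m ⊔ ℓm) ⊔ q)
    I3 = ∀ (I J : Subspace) → 𝓘 I → 𝓘 J → DimLt I J → Extends I J

    I1′ : Set q
    I1′ = 𝓘 zeroSub

    I3′ : Set (c ⊔ ℓ ⊔ lsuc (m ⊔ ℓm) ⊔ q)
    I3′ = ∀ (I J : Subspace) → 𝓘 I → 𝓘 J → DimSucc I J → Extends I J

-- (I1,I2,I3) ⇒ (I1′,I2,I3′) is immediate: the zero subspace lies in every
-- member of the nonempty family, so (I2) puts it in 𝓘; and (I3′) is the case
-- dim J = dim I + 1 of (I3).
--
-- (I1′,I2,I3′) ⇒ (I1,I2,I3) rests on one fact of linear algebra: a subspace J
-- of dimension e contains a subspace J′ of every dimension n ≤ e, namely the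
-- span of the last n vectors of a basis of J.  Given I, J ∈ 𝓘 with
-- dim I = d < dim J, choose J′ ⊆ J with dim J′ = d + 1; then J′ ∈ 𝓘 by (I2),
-- and (I3′) applied to I and J′ yields x ⊆ J′ ⊆ J, as (I3) asks.
module Submission where

open import Defs
open import Level using (Level; lower)
open import Data.Nat using (ℕ; zero; suc; _+_; _∸_; _<_; _≤_)
open import Data.Nat.Properties using (+-comm; m∸n+n≡m; n<1+n)
open import Data.Fin using (Fin; zero; suc; _↑ʳ_)
open import Data.Product using (Σ; ∃; _×_; _,_; proj₁; proj₂)
open import Data.Vec.Functional using (_∷_; tail; drop)
open import Function.Bundles using (_⇔_; mk⇔)
open import Relation.Binary.PropositionalEquality using (_≡_; refl; subst; sym)
open import Algebra.Bundles using (CommutativeRing; CommutativeMonoid)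
open import Algebra.Module.Bundles using (Module)
import Algebra.Properties.CommutativeSemigroup as CommutativeSemigroupProperties
import Algebra.Properties.AbelianGroup as AbelianGroupProperties
import Algebra.Properties.Ring as RingProperties
import Relation.Binary.Reasoning.Setoid as SetoidReasoning

module LinearAlgebra {c ℓ m ℓm : Level} (K : CommutativeRing c ℓ) (E : Module K m ℓm) where
  open CommutativeRing K using (Carrier; _≈_; 0#; 1#; _*_; _-_; ring; reflexive)
    renaming (_+_ to _+ₖ_)
  open Module E
  open VectorSpace K E
  open CommutativeSemigroupProperties
    (CommutativeMonoid.commutativeSemigroup +ᴹ-commutativeMonoid) using (interchange)
  open AbelianGroupProperties +ᴹ-abelianGroup using (identityˡ-unique)
  open RingProperties ring using (x∙y⁻¹≈ε⇒x≈y; //-rightDividesˡ)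
  open SetoidReasoning ≈ᴹ-setoid

  linComb-cong : ∀ {d} {a b : Fin d → Carrier} (vs : Fin d → Carrierᴹ) →
    (∀ i → a i ≈ b i) → linComb a vs ≈ᴹ linComb b vs
  linComb-cong {zero}  vs a≈b = ≈ᴹ-refl
  linComb-cong {suc d} vs a≈b =
    +ᴹ-cong (*ₗ-cong (a≈b zero) ≈ᴹ-refl) (linComb-cong (tail vs) (λ i → a≈b (suc i)))

  linComb-zero : ∀ {d} (vs : Fin d → Carrierᴹ) → linComb (λ _ → 0#) vs ≈ᴹ 0ᴹ
  linComb-zero {zero}  vs = ≈ᴹ-refl
  linComb-zero {suc d} vs =
    ≈ᴹ-trans (+ᴹ-cong (*ₗ-zeroˡ (vs zero)) (linComb-zero (tail vs))) (+ᴹ-identityˡ 0ᴹ)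

  linComb-+ : ∀ {d} (a b : Fin d → Carrier) (vs : Fin d → Carrierᴹ) →
    linComb (λ i → a i +ₖ b i) vs ≈ᴹ linComb a vs +ᴹ linComb b vs
  linComb-+ {zero}  a b vs = ≈ᴹ-sym (+ᴹ-identityˡ 0ᴹ)
  linComb-+ {suc d} a b vs =
    ≈ᴹ-trans (+ᴹ-cong (*ₗ-distribʳ (vs zero) (a zero) (b zero))
                      (linComb-+ (tail a) (tail b) (tail vs)))
             (interchange _ _ _ _)

  linComb-* : ∀ {d} (r : Carrier) (a : Fin d → Carrier) (vs : Fin d → Carrierᴹ) →
    linComb (λ i → r * a i) vs ≈ᴹ r *ₗ linComb a vs
  linComb-* {zero}  r a vs = ≈ᴹ-sym (*ₗ-zeroʳ r)
  linComb-* {suc d} r a vs =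
    ≈ᴹ-trans (+ᴹ-cong (*ₗ-assoc r (a zero) (vs zero)) (linComb-* r (tail a) (tail vs)))
             (≈ᴹ-sym (*ₗ-distribˡ r _ _))

  member-inSpan : ∀ {d} (vs : Fin d → Carrierᴹ) (j : Fin d) → InSpan vs (vs j)
  member-inSpan vs zero = (1# ∷ λ _ → 0#) , ≈ᴹ-sym (begin
    1# *ₗ vs zero +ᴹ linComb (λ _ → 0#) (tail vs)
      ≈⟨ +ᴹ-cong (*ₗ-identityˡ (vs zero)) (linComb-zero (tail vs)) ⟩
    vs zero +ᴹ 0ᴹ
      ≈⟨ +ᴹ-identityʳ (vs zero) ⟩
    vs zero ∎)
  member-inSpan vs (suc j) with member-inSpan (tail vs) j
  ... | a , vsj≈ = (0# ∷ a) , ≈ᴹ-sym (begin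
    0# *ₗ vs zero +ᴹ linComb a (tail vs) ≈⟨ +ᴹ-cong (*ₗ-zeroˡ (vs zero)) (≈ᴹ-sym vsj≈) ⟩
    0ᴹ +ᴹ vs (suc j)                      ≈⟨ +ᴹ-identityˡ (vs (suc j)) ⟩
    vs (suc j)                            ∎)

  -- Coordinates with respect to a linearly independent family are unique:
  -- the difference of two coordinate vectors is a vanishing combination.
  coordinates-unique : ∀ {d} (vs : Fin d → Carrierᴹ) → LinearlyIndependent vs →
    ∀ a b → linComb a vs ≈ᴹ linComb b vs → ∀ i → a i ≈ b i
  coordinates-unique vs indep a b a≈b i =
    x∙y⁻¹≈ε⇒x≈y (a i) (b i) (indep (λ j → a j - b j) difference≈0 i)
    where
    difference≈0 : linComb (λ j → a j - b j) vs ≈ᴹ 0ᴹ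
    difference≈0 = identityˡ-unique _ (linComb b vs) (begin
      linComb (λ j → a j - b j) vs +ᴹ linComb b vs ≈⟨ linComb-+ _ b vs ⟨
      linComb (λ j → (a j - b j) +ₖ b j) vs        ≈⟨ linComb-cong vs (λ j → //-rightDividesˡ (b j) (a j)) ⟩
      linComb a vs                                 ≈⟨ a≈b ⟩
      linComb b vs                                 ∎)

  pad : ∀ k {n} → (Fin n → Carrier) → Fin (k + n) → Carrier
  pad zero    b = b
  pad (suc k) b = 0# ∷ pad k b

  pad-drop : ∀ k {n} (b : Fin n → Carrier) (i : Fin n) → pad k b (k ↑ʳ i) ≡ b i
  pad-drop zero    b i = refl
  pad-drop (suc k) b i = pad-drop k b i

  linComb-pad : ∀ k {n} (b : Fin n → Carrier) (vs : Fin (k + n) → Carrierᴹ) →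
    linComb (pad k b) vs ≈ᴹ linComb b (drop k vs)
  linComb-pad zero    b vs = ≈ᴹ-refl
  linComb-pad (suc k) b vs =
    ≈ᴹ-trans (+ᴹ-cong (*ₗ-zeroˡ (vs zero)) (linComb-pad k b (tail vs))) (+ᴹ-identityˡ _)

  independent-drop : ∀ k {n} (vs : Fin (k + n) → Carrierᴹ) →
    LinearlyIndependent vs → LinearlyIndependent (drop k vs)
  independent-drop k vs indep b b·drop≈0 i =
    subst (_≈ 0#) (pad-drop k b i) (indep (pad k b) (≈ᴹ-trans (linComb-pad k b vs) b·drop≈0) (k ↑ʳ i))

  -- Given a basis vs of J of size k + n, the subspace spanned by its last n
  -- vectors.  Its membership predicate must live at the level of subsets of E,
  -- so it cannot quantify over coefficients; instead w belongs to it when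
  -- w ∈ J and w equals its projection, i.e. the part of its expansion in the
  -- basis that uses only the last n vectors.
  module TailSpan (J : Subspace) (k : ℕ) {n : ℕ}
                  (vs : Fin (k + n) → Carrierᴹ) (basis : IsBasisOf J vs) where
    vs∈J : ∀ i → J ∈ vs i
    vs∈J = proj₁ basis

    independent : LinearlyIndependent vs
    independent = proj₁ (proj₂ basis)

    coordinates : ∀ {w} → J ∈ w → Fin (k + n) → Carrier
    coordinates {w} w∈J = proj₁ (proj₂ (proj₂ basis) w w∈J)

    coordinates-spec : ∀ {w} (w∈J : J ∈ w) → w ≈ᴹ linComb (coordinates w∈J) vs
    coordinates-spec {w} w∈J = proj₂ (proj₂ (proj₂ basis) w w∈J)

    projection : ∀ {w} → J ∈ w → Carrierᴹ
    projection w∈J = linComb (drop k (coordinates w∈J)) (drop k vs)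

    projection-by : ∀ {w} (w∈J : J ∈ w) a → w ≈ᴹ linComb a vs →
      projection w∈J ≈ᴹ linComb (drop k a) (drop k vs)
    projection-by w∈J a w≈ = linComb-cong (drop k vs) (λ i →
      coordinates-unique vs independent (coordinates w∈J) a
        (≈ᴹ-trans (≈ᴹ-sym (coordinates-spec w∈J)) w≈) (k ↑ʳ i))

    Tail : Subspace
    Tail = record
      { _∈_      = λ w → Σ (J ∈ w) λ w∈J → w ≈ᴹ projection w∈J
      ; ∈-resp-≈ = λ {u} {v} u≈v (u∈J , u≈) →
          let v∈J = Subspace.∈-resp-≈ J u≈v u∈J in
          v∈J , ≈ᴹ-trans (≈ᴹ-sym u≈v) (≈ᴹ-trans u≈ (≈ᴹ-sym (projection-by v∈J _
                  (≈ᴹ-trans (≈ᴹ-sym u≈v) (coordinates-spec u∈J)))))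
      ; 0∈       = let 0∈J = Subspace.0∈ J in
          0∈J , ≈ᴹ-sym (≈ᴹ-trans (projection-by 0∈J _ (≈ᴹ-sym (linComb-zero vs)))
                                 (linComb-zero (drop k vs)))
      ; +-closed = λ {u} {v} (u∈J , u≈) (v∈J , v≈) →
          let a = coordinates u∈J
              b = coordinates v∈J
              u+v∈J = Subspace.+-closed J u∈J v∈J
          in u+v∈J , ≈ᴹ-sym (begin
            projection u+v∈J
              ≈⟨ projection-by u+v∈J (λ i → a i +ₖ b i) (≈ᴹ-trans
                   (+ᴹ-cong (coordinates-spec u∈J) (coordinates-spec v∈J)) (≈ᴹ-sym (linComb-+ a b vs))) ⟩
            linComb (λ i → drop k a i +ₖ drop k b i) (drop k vs)
              ≈⟨ linComb-+ (drop k a) (drop k b) (drop k vs) ⟩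
            projection u∈J +ᴹ projection v∈J
              ≈⟨ +ᴹ-cong u≈ v≈ ⟨
            u +ᴹ v ∎)
      ; *-closed = λ r {u} (u∈J , u≈) →
          let a = coordinates u∈J
              ru∈J = Subspace.*-closed J r u∈J
          in ru∈J , ≈ᴹ-sym (begin
            projection ru∈J
              ≈⟨ projection-by ru∈J (λ i → r * a i) (≈ᴹ-trans
                   (*ₗ-congˡ (coordinates-spec u∈J)) (≈ᴹ-sym (linComb-* r a vs))) ⟩
            linComb (λ i → r * drop k a i) (drop k vs)
              ≈⟨ linComb-* r (drop k a) (drop k vs) ⟩
            r *ₗ projection u∈J
              ≈⟨ *ₗ-congˡ u≈ ⟨
            r *ₗ u ∎)
      }

    Tail-⊆ : Tail ⊆ J
    Tail-⊆ w (w∈J , _) = w∈J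

    drop∈Tail : ∀ i → Tail ∈ drop k vs i
    drop∈Tail i with member-inSpan (drop k vs) i
    ... | b , vi≈ = vs∈J (k ↑ʳ i) , ≈ᴹ-sym (begin
      projection (vs∈J (k ↑ʳ i))
        ≈⟨ projection-by (vs∈J (k ↑ʳ i)) (pad k b) (≈ᴹ-trans vi≈ (≈ᴹ-sym (linComb-pad k b vs))) ⟩
      linComb (drop k (pad k b)) (drop k vs)
        ≈⟨ linComb-cong (drop k vs) (λ j → reflexive (pad-drop k b j)) ⟩
      linComb b (drop k vs)
        ≈⟨ vi≈ ⟨
      drop k vs i ∎)

    Tail-dim : HasDim Tail n
    Tail-dim = drop k vs , drop∈Tail , independent-drop k vs independent ,
               λ { w (w∈J , w≈) → drop k (coordinates w∈J) , w≈ }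

  -- A subspace of dimension e contains a subspace of every dimension n ≤ e:
  -- write e = (e ∸ n) + n and take the span of the last n basis vectors.
  subspace-of-dim : ∀ (J : Subspace) {e n} → HasDim J e → n ≤ e →
    ∃ λ (J′ : Subspace) → J′ ⊆ J × HasDim J′ n
  subspace-of-dim J {e} {n} dimJ n≤e
    with vs , basis ← subst (HasDim J) (sym (m∸n+n≡m n≤e)) dimJ =
    Tail , Tail-⊆ , Tail-dim
    where open TailSpan J (e ∸ n) vs basis

module Axioms {c ℓ m ℓm q : Level} (K : CommutativeRing c ℓ) (E : Module K m ℓm)
              (𝓘 : VectorSpace.Subspace K E → Set q) where
  open Module E using (≈ᴹ-sym)
  open VectorSpace K E
  open Conditions 𝓘
  open LinearAlgebra K E using (subspace-of-dim)

  zeroSub-⊆ : ∀ (I : Subspace) → zeroSub ⊆ I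
  zeroSub-⊆ I v v≈0 = Subspace.∈-resp-≈ I (≈ᴹ-sym (lower v≈0)) (Subspace.0∈ I)

  DimSucc⇒DimLt : ∀ I J → DimSucc I J → DimLt I J
  DimSucc⇒DimLt I J (d , dimI , dimJ) = d , d + 1 , dimI , dimJ , subst (d <_) (+-comm 1 d) (n<1+n d)

  Extends-mono : ∀ I J′ J → J′ ⊆ J → Extends I J′ → Extends I J
  Extends-mono I J′ J J′⊆J (x , dimx , x⊆J′ , x⊈I , I+x∈𝓘) =
    x , dimx , (λ v v∈x → J′⊆J v (x⊆J′ v v∈x)) , x⊈I , I+x∈𝓘

  -- (I3′) and (I2) give (I3): pass from J to a subspace of dimension dim I + 1.
  I3′⇒I3 : I2 → I3′ → I3
  I3′⇒I3 i2 i3′ I J I∈𝓘 J∈𝓘 (d , e , dimI , dimJ , d<e)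
    with subspace-of-dim J dimJ (subst (_≤ e) (+-comm 1 d) d<e)
  ... | J′ , J′⊆J , dimJ′ =
    Extends-mono I J′ J J′⊆J (i3′ I J′ I∈𝓘 (i2 J′ J J∈𝓘 J′⊆J) (d , dimI , dimJ′))

  forward : I1 × I2 × I3 → I1′ × I2 × I3′
  forward ((I , I∈𝓘) , i2 , i3) =
    i2 zeroSub I I∈𝓘 (zeroSub-⊆ I) ,
    i2 ,
    λ I J I∈𝓘 J∈𝓘 dimSucc → i3 I J I∈𝓘 J∈𝓘 (DimSucc⇒DimLt I J dimSucc)

  backward : I1′ × I2 × I3′ → I1 × I2 × I3
  backward (i1′ , i2 , i3′) = (zeroSub , i1′) , i2 , I3′⇒I3 i2 i3′

proposition3p9 : ∀ {c ℓ m ℓm q : Level}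
    (K : CommutativeRing c ℓ) → IsField K →
    (E : Module K m ℓm) → VectorSpace.FiniteDimensional K E →
    (𝓘 : VectorSpace.Subspace K E → Set q) →
    let open VectorSpace.Conditions K E 𝓘 in
    (I1 × I2 × I3) ⇔ (I1′ × I2 × I3′)
proposition3p9 K _ E _ 𝓘 = mk⇔ forward backward
  where open Axioms K E 𝓘
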